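{- For every positive integer $\Delta\geq 9$ there is a connected bipartite multigraph $G$ with maximum degree $\Delta(G)=\Delta$ such that $G\notin\mathfrak{N}$.
   Context: Multigraphs are finite and may have multiple edges but no loops. An interval $t$-coloring of a multigraph $G$ is a proper edge-coloring (edges sharing an endpoint get distinct colors) with colors $1,\ldots,t$ such that every color is used and for every vertex $v$ the set of colors of edges incident to $v$ is an interval of integers. $\mathfrak{N}$ denotes the set of multigraphs having an interval $t$-coloring for some positive integer $t$. -}

module Defs where

open import Data.Nat using (ℕ; suc; _≤_)
open import Data.Fin using (Fin; _≟_)
open import Data.Bool using (Bool)
open import Data.List using (length; filter; allFin)
open import Data.Product using (_×_; proj₁; proj₂; ∃; ∃-syntax; Σ-syntax)
open import Data.Sum using (_⊎_)
open import Relation.Nullary using (¬_; Dec)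
open import Relation.Nullary.Decidable using (_⊎-dec_)
open import Relation.Binary.PropositionalEquality using (_≡_; _≢_)

record Multigraph : Set where
  field
    n     : ℕ
    m     : ℕ
    ends  : Fin m → Fin n × Fin n
    noLoop : ∀ e → proj₁ (ends e) ≢ proj₂ (ends e)

module _ (G : Multigraph) where
  open Multigraph G

  Incident : Fin m → Fin n → Set
  Incident e v = proj₁ (ends e) ≡ v ⊎ proj₂ (ends e) ≡ v

  incident? : ∀ v e → Dec (Incident e v)
  incident? v e = (proj₁ (ends e) ≟ v) ⊎-dec (proj₂ (ends e) ≟ v)

  degree : Fin n → ℕ
  degree v = length (filter (incident? v) (allFin m))

  MaxDegree : ℕ → Set
  MaxDegree Δ = (∀ v → degree v ≤ Δ) × (∃[ v ] degree v ≡ Δ)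

  Adjacent : Fin n → Fin n → Set
  Adjacent u w = ∃[ e ] (ends e ≡ (u Data.Product., w) ⊎ ends e ≡ (w Data.Product., u))

  data Walk : Fin n → Fin n → Set where
    here : ∀ {u} → Walk u u
    step : ∀ {u w v} → Adjacent u w → Walk w v → Walk u v

  Connected : Set
  Connected = ∀ u v → Walk u v

  Bipartite : Set
  Bipartite = Σ[ side ∈ (Fin n → Bool) ] (∀ e → side (proj₁ (ends e)) ≢ side (proj₂ (ends e)))

  record IntervalColoring (t : ℕ) : Set where
    field
      c        : Fin m → ℕ
      range    : ∀ e → 1 ≤ c e × c e ≤ t
      proper   : ∀ e e′ v → e ≢ e′ → Incident e v → Incident e′ v → c e ≢ c e′
      allUsed  : ∀ k → 1 ≤ k → k ≤ t → ∃[ e ] c e ≡ k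
      interval : ∀ v e₁ e₂ k → Incident e₁ v → Incident e₂ v →
                 c e₁ ≤ k → k ≤ c e₂ → ∃[ e ] (Incident e v × c e ≡ k)

  InN : Set
  InN = ∃[ t ] (1 ≤ t × IntervalColoring t)

module Submission where

-- The only property of interval colourings that is used is the spread bound:
-- the colours at a vertex v are distinct and form an interval, so any two of
-- them differ by less than deg v.  Together with a pigeonhole principle for
-- distinct naturals confined to a window, this rules out colourings of
-- "fans": a hub joined by single spokes to middle vertices u₀, …, u_{k-1},
-- each u_a joined by parallel ribs to a top vertex.  The top vertex carries
-- Δ distinct rib colours, while every rib colour is tied to the spoke
-- colours through its middle vertex, and the spoke colours are tied to each
-- other through the hub.  For Δ ≥ 10 this confines all rib colours to a
-- window of Δ - 1 values around the least one; for Δ = 9 a case analysis on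
-- the least and greatest rib colours gives the same kind of contradiction.

open import Defs
open import Data.Bool using (Bool; true; false)
open import Data.Empty using (⊥; ⊥-elim)
open import Data.Fin as Fin using (Fin; zero; suc; toℕ; fromℕ<; _↑ˡ_; _↑ʳ_; splitAt)
open import Data.Fin.Properties
  using (injective⇒≤; toℕ-injective; toℕ-fromℕ<; toℕ<n; ↑ˡ-injective; ↑ʳ-injective; splitAt-↑ˡ; splitAt-↑ʳ)
open import Data.List using (List; length; filter; allFin; lookup; tabulate)
open import Data.List.Properties using (filter-all; filter-none; length-tabulate)
open import Data.List.Extrema.Nat using (argmin; argmax; f[argmin]≤f[xs]; f[xs]≤f[argmax])
open import Data.List.Membership.Propositional using (_∈_)
open import Data.List.Membership.Propositional.Properties using (∈-filter⁺; ∈-allFin)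
import Data.List.Relation.Unary.All as All
open import Data.List.Relation.Unary.All.Properties using (tabulate⁺)
open import Data.List.Relation.Unary.Any using (index)
open import Data.List.Relation.Unary.Any.Properties using (lookup-index)
open import Data.Nat using (ℕ; zero; suc; _+_; _∸_; _≤_; _<_; _≤?_; s≤s)
open import Data.Nat.Properties
open import Data.Product using (_×_; _,_; proj₁; proj₂; ∃-syntax)
open import Data.Sum using (_⊎_; inj₁; inj₂; [_,_]′)
open import Relation.Binary.PropositionalEquality
  using (_≡_; _≢_; refl; sym; trans; cong; subst)
open import Relation.Nullary using (¬_; Dec; yes; no)

Injective : ∀ {N} → (Fin N → ℕ) → Set
Injective f = ∀ {i j} → f i ≡ f j → i ≡ j

distinct-in-window : ∀ {N} (f : Fin N → ℕ) (a L : ℕ) →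
  (∀ i → a ≤ f i) → (∀ i → f i ≤ L + a) → Injective f → N ≤ suc L
distinct-in-window f a L above below f-inj = injective⇒≤ offset-injective
  where
  offset-bound : ∀ i → f i ∸ a < suc L
  offset-bound i = s≤s (m≤n+o⇒m∸n≤o (f i) a (subst (f i ≤_) (+-comm L a) (below i)))

  offset : ∀ i → Fin (suc L)
  offset i = fromℕ< (offset-bound i)

  offset-injective : ∀ {i j} → offset i ≡ offset j → i ≡ j
  offset-injective {i} {j} eq = f-inj (∸-cancelʳ-≡ (above i) (above j)
    (trans (sym (toℕ-fromℕ< (offset-bound i)))
      (trans (cong toℕ eq) (toℕ-fromℕ< (offset-bound j)))))

prepend : ∀ {N} → ℕ → (Fin N → ℕ) → Fin (suc N) → ℕ
prepend v f zero = v
prepend v f (suc j) = f j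

prepend-injective : ∀ {N} (v : ℕ) (f : Fin N → ℕ) → (∀ j → f j ≢ v) →
  Injective f → Injective (prepend v f)
prepend-injective v f fresh f-inj {zero}  {zero}  _  = refl
prepend-injective v f fresh f-inj {zero}  {suc j} eq = ⊥-elim (fresh j (sym eq))
prepend-injective v f fresh f-inj {suc i} {zero}  eq = ⊥-elim (fresh i eq)
prepend-injective v f fresh f-inj {suc i} {suc j} eq = cong suc (f-inj eq)

minimiser : ∀ {n} (f : Fin (suc n) → ℕ) → ∃[ i ] (∀ j → f i ≤ f j)
minimiser {n} f = argmin f zero (allFin (suc n)) ,
  λ j → All.lookup (f[argmin]≤f[xs] {f = f} zero (allFin (suc n))) (∈-allFin j)

maximiser : ∀ {n} (f : Fin (suc n) → ℕ) → ∃[ i ] (∀ j → f j ≤ f i)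
maximiser {n} f = argmax f zero (allFin (suc n)) ,
  λ j → All.lookup (f[xs]≤f[argmax] {f = f} zero (allFin (suc n))) (∈-allFin j)

middle-value : ∀ {s n} → s ≤ n → n ≤ 2 + s → n ≢ s → n ≢ 2 + s → n ≡ 1 + s
middle-value s≤n n≤2+s n≢s n≢2+s =
  ≤-antisym (≤-pred (≤∧≢⇒< n≤2+s n≢2+s)) (≤∧≢⇒< s≤n (λ eq → n≢s (sym eq)))

_++ʷ_ : ∀ {G u v w} → Walk G u v → Walk G v w → Walk G u w
here        ++ʷ q = q
step adj p  ++ʷ q = step adj (p ++ʷ q)

incident-family≤degree : (G : Multigraph) (v : Fin (Multigraph.n G)) {N : ℕ}
  (g : Fin N → Fin (Multigraph.m G)) → (∀ i → Incident G (g i) v) →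
  (∀ {i j} → g i ≡ g j → i ≡ j) → N ≤ degree G v
incident-family≤degree G v {N} g at-v g-inj = injective⇒≤ position-injective
  where
  edges-at-v : List (Fin (Multigraph.m G))
  edges-at-v = filter (incident? G v) (allFin (Multigraph.m G))

  listed : ∀ i → g i ∈ edges-at-v
  listed i = ∈-filter⁺ (incident? G v) (∈-allFin (g i)) (at-v i)

  position-injective : ∀ {i j} → index (listed i) ≡ index (listed j) → i ≡ j
  position-injective {i} {j} eq = g-inj (trans (lookup-index (listed i))
    (trans (cong (lookup edges-at-v) eq) (sym (lookup-index (listed j)))))

module ColouringFacts {G : Multigraph} {t : ℕ} (col : IntervalColoring G t) where
  open Multigraph G using (m)
  open IntervalColoring col

  colour-injective-at : ∀ {v e₁ e₂} → Incident G e₁ v → Incident G e₂ v →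
    c e₁ ≡ c e₂ → e₁ ≡ e₂
  colour-injective-at {v} {e₁} {e₂} at₁ at₂ eq with e₁ Fin.≟ e₂
  ... | yes same = same
  ... | no differ = ⊥-elim (proper e₁ e₂ v differ at₁ at₂ eq)

  -- The colours c e₁, c e₁ + 1, …, c e₂ all occur on distinct edges at v.
  gap<degree : ∀ {v e₁ e₂} → Incident G e₁ v → Incident G e₂ v →
    c e₁ ≤ c e₂ → c e₂ ∸ c e₁ < degree G v
  gap<degree {v} {e₁} {e₂} at₁ at₂ le =
    incident-family≤degree G v edge-of (λ i → proj₁ (proj₂ (witness i))) edge-injective
    where
    witness : (i : Fin (suc (c e₂ ∸ c e₁))) → ∃[ e ] (Incident G e v × c e ≡ c e₁ + toℕ i)
    witness i = interval v e₁ e₂ (c e₁ + toℕ i) at₁ at₂ (m≤m+n (c e₁) (toℕ i))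
      (subst (c e₁ + toℕ i ≤_) (m+[n∸m]≡n le) (+-monoʳ-≤ (c e₁) (≤-pred (toℕ<n i))))

    edge-of : Fin (suc (c e₂ ∸ c e₁)) → Fin m
    edge-of i = proj₁ (witness i)

    edge-injective : ∀ {i j} → edge-of i ≡ edge-of j → i ≡ j
    edge-injective {i} {j} eq = toℕ-injective (+-cancelˡ-≡ (c e₁) _ _
      (trans (sym (proj₂ (proj₂ (witness i))))
        (trans (cong c eq) (proj₂ (proj₂ (witness j))))))

  colour-spread : ∀ {v e₁ e₂} → Incident G e₁ v → Incident G e₂ v →
    c e₂ < degree G v + c e₁
  colour-spread {v} {e₁} {e₂} at₁ at₂ with c e₁ ≤? c e₂
  ... | yes le = begin-strict
    c e₂                   ≡⟨ m+[n∸m]≡n le ⟨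
    c e₁ + (c e₂ ∸ c e₁)   <⟨ +-monoʳ-< (c e₁) (gap<degree at₁ at₂ le) ⟩
    c e₁ + degree G v      ≡⟨ +-comm (c e₁) (degree G v) ⟩
    degree G v + c e₁      ∎
    where open ≤-Reasoning
  ... | no gt = <-≤-trans (≰⇒> gt) (m≤n+m (c e₁) (degree G v))

  colours-within : ∀ {v e₁ e₂ d} → degree G v ≤ suc d →
    Incident G e₁ v → Incident G e₂ v → c e₂ ≤ d + c e₁
  colours-within {e₁ = e₁} deg≤ at₁ at₂ =
    ≤-pred (<-≤-trans (colour-spread at₁ at₂) (+-monoˡ-≤ (c e₁) deg≤))

-- The fan: hub joined by a spoke to each middle vertex mid a (a : Fin k),
-- and N ribs, rib j joining mid (owner j) to the top vertex.
module Fan (k N : ℕ) (owner : Fin N → Fin k) where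

  Vertex Edge : Set
  Vertex = Fin (2 + k)
  Edge   = Fin (k + N)

  hub top : Vertex
  hub = zero
  top = suc zero

  mid : Fin k → Vertex
  mid a = suc (suc a)

  spoke : Fin k → Edge
  spoke a = a ↑ˡ N

  rib : Fin N → Edge
  rib j = k ↑ʳ j

  endsOf : Fin k ⊎ Fin N → Vertex × Vertex
  endsOf = [ (λ a → hub , mid a) , (λ j → mid (owner j) , top) ]′

  ends : Edge → Vertex × Vertex
  ends e = endsOf (splitAt k e)

  loopless : ∀ s → proj₁ (endsOf s) ≢ proj₂ (endsOf s)
  loopless (inj₁ _) ()
  loopless (inj₂ _) ()

  graph : Multigraph
  graph = record { n = 2 + k ; m = k + N ; ends = ends ; noLoop = λ e → loopless (splitAt k e) }

  spoke-ends : ∀ a → ends (spoke a) ≡ (hub , mid a)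
  spoke-ends a = cong endsOf (splitAt-↑ˡ k a N)

  rib-ends : ∀ j → ends (rib j) ≡ (mid (owner j) , top)
  rib-ends j = cong endsOf (splitAt-↑ʳ k N j)

  spoke-at-hub : ∀ a → Incident graph (spoke a) hub
  spoke-at-hub a = inj₁ (cong proj₁ (spoke-ends a))

  spoke-at-mid : ∀ a → Incident graph (spoke a) (mid a)
  spoke-at-mid a = inj₂ (cong proj₂ (spoke-ends a))

  rib-at-mid : ∀ {j a} → owner j ≡ a → Incident graph (rib j) (mid a)
  rib-at-mid {j} refl = inj₁ (cong proj₁ (rib-ends j))

  rib-at-top : ∀ j → Incident graph (rib j) top
  rib-at-top j = inj₂ (cong proj₂ (rib-ends j))

  spoke≢rib : ∀ a j → spoke a ≢ rib j
  spoke≢rib a j eq with trans (sym (splitAt-↑ˡ k a N)) (trans (cong (splitAt k) eq) (splitAt-↑ʳ k N j))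
  ... | ()

  connected : Fin N → Connected graph
  connected j₀ u v = to-hub u ++ʷ from-hub v
    where
    to-hub : ∀ v → Walk graph v hub
    to-hub zero = here
    to-hub (suc zero) = step (rib j₀ , inj₂ (rib-ends j₀))
                          (step (spoke (owner j₀) , inj₂ (spoke-ends (owner j₀))) here)
    to-hub (suc (suc a)) = step (spoke a , inj₂ (spoke-ends a)) here

    from-hub : ∀ v → Walk graph hub v
    from-hub zero = here
    from-hub (suc zero) = step (spoke (owner j₀) , inj₁ (spoke-ends (owner j₀)))
                            (step (rib j₀ , inj₁ (rib-ends j₀)) here)
    from-hub (suc (suc a)) = step (spoke a , inj₁ (spoke-ends a)) here

  bipartite : Bipartite graph
  bipartite = side , λ e → crosses (splitAt k e)
    where
    side : Vertex → Bool
    side zero = true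
    side (suc zero) = true
    side (suc (suc _)) = false

    crosses : ∀ s → side (proj₁ (endsOf s)) ≢ side (proj₂ (endsOf s))
    crosses (inj₁ _) ()
    crosses (inj₂ _) ()

  module Coloured {t : ℕ} (col : IntervalColoring graph t) where
    open IntervalColoring col
    open ColouringFacts col

    ribColour : Fin N → ℕ
    ribColour j = c (rib j)

    spokeColour : Fin k → ℕ
    spokeColour a = c (spoke a)

    ribColour-injective : Injective ribColour
    ribColour-injective eq = ↑ʳ-injective k _ _ (colour-injective-at (rib-at-top _) (rib-at-top _) eq)

    spokeColour-injective : Injective spokeColour
    spokeColour-injective eq = ↑ˡ-injective N _ _ (colour-injective-at (spoke-at-hub _) (spoke-at-hub _) eq)

    spokes-close : ∀ {d} → degree graph hub ≤ suc d → ∀ a b → spokeColour b ≤ d + spokeColour a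
    spokes-close deg≤ a b = colours-within deg≤ (spoke-at-hub a) (spoke-at-hub b)

    rib-below-spoke : ∀ {d a j} → degree graph (mid a) ≤ suc d → owner j ≡ a →
      ribColour j ≤ d + spokeColour a
    rib-below-spoke {a = a} deg≤ owns = colours-within deg≤ (spoke-at-mid a) (rib-at-mid owns)

    spoke-below-rib : ∀ {d a j} → degree graph (mid a) ≤ suc d → owner j ≡ a →
      spokeColour a ≤ d + ribColour j
    spoke-below-rib {a = a} deg≤ owns = colours-within deg≤ (rib-at-mid owns) (spoke-at-mid a)

    ribs-close : ∀ {d a i j} → degree graph (mid a) ≤ suc d → owner i ≡ a → owner j ≡ a →
      ribColour j ≤ d + ribColour i
    ribs-close deg≤ owns-i owns-j = colours-within deg≤ (rib-at-mid owns-i) (rib-at-mid owns-j)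

    rib≢spoke : ∀ {a j} → owner j ≡ a → ribColour j ≢ spokeColour a
    rib≢spoke {a} {j} owns eq = spoke≢rib a j (sym (colour-injective-at (rib-at-mid owns) (spoke-at-mid a) eq))

-- Δ = 9: three middle vertices, each with three ribs (owner j = ⌊j/3⌋).
module NineCounterexample where
  owner : Fin 9 → Fin 3
  owner = Fin.quotient 3

  open Fan 3 9 owner

  hub-degree : degree graph hub ≡ 3
  hub-degree = refl

  top-degree : degree graph top ≡ 9
  top-degree = refl

  mid-degree : ∀ a → degree graph (mid a) ≡ 4
  mid-degree zero = refl
  mid-degree (suc zero) = refl
  mid-degree (suc (suc zero)) = refl

  max-degree : MaxDegree graph 9
  max-degree = bound , top , top-degree
    where
    bound : ∀ v → degree graph v ≤ 9
    bound zero = subst (_≤ 9) (sym hub-degree) (m≤m+n 3 6)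
    bound (suc zero) = ≤-refl
    bound (suc (suc a)) = subst (_≤ 9) (sym (mid-degree a)) (m≤m+n 4 5)

  -- With s the least spoke colour and x₀ ≤ x₁ the extreme rib colours,
  -- all rib colours lie in [s - 3, s + 5].  Three cases exclude a colouring.
  module _ {t : ℕ} (col : IntervalColoring graph t) where
    open Coloured col

    a₀ : Fin 3
    a₀ = proj₁ (minimiser spokeColour)

    j₀ j₁ : Fin 9
    j₀ = proj₁ (minimiser ribColour)
    j₁ = proj₁ (maximiser ribColour)

    s x₀ x₁ : ℕ
    s  = spokeColour a₀
    x₀ = ribColour j₀
    x₁ = ribColour j₁

    s-least : ∀ a → s ≤ spokeColour a
    s-least = proj₂ (minimiser spokeColour)

    x₀-least : ∀ j → x₀ ≤ ribColour j
    x₀-least = proj₂ (minimiser ribColour)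

    x₁-greatest : ∀ j → ribColour j ≤ x₁
    x₁-greatest = proj₂ (maximiser ribColour)

    mid-degree≤ : ∀ a → degree graph (mid a) ≤ 4
    mid-degree≤ a = ≤-reflexive (mid-degree a)

    spokes-in-window : ∀ a → spokeColour a ≤ 2 + s
    spokes-in-window = spokes-close (≤-reflexive hub-degree) a₀

    ribs-above : ∀ j → ribColour j ≤ 5 + s
    ribs-above j = ≤-trans (rib-below-spoke (mid-degree≤ (owner j)) refl)
                           (+-monoʳ-≤ 3 (spokes-in-window (owner j)))

    ribs-below : ∀ j → s ≤ 3 + ribColour j
    ribs-below j = ≤-trans (s-least (owner j)) (spoke-below-rib (mid-degree≤ (owner j)) refl)

    -- If x₀ ≥ s - 2, nine distinct rib colours lie in [x₀, x₀ + 7].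
    low-case : s ≤ 2 + x₀ → ⊥
    low-case s≤ = 1+n≰n (distinct-in-window ribColour x₀ 7 x₀-least
      (λ j → ≤-trans (ribs-above j) (+-monoʳ-≤ 5 s≤)) ribColour-injective)

    shifted : Fin 9 → ℕ
    shifted j = 3 + ribColour j

    shifted-injective : Injective shifted
    shifted-injective eq = ribColour-injective (+-cancelˡ-≡ 3 _ _ eq)

    -- If x₁ ≤ s + 4, the shifted rib colours lie in [s, s + 7].
    high-case : x₁ ≤ 4 + s → ⊥
    high-case ≤s = 1+n≰n (distinct-in-window shifted s 7 ribs-below
      (λ j → +-monoʳ-≤ 3 (≤-trans (x₁-greatest j) ≤s)) shifted-injective)

    -- Otherwise owner j₀ has spoke colour s and all its ribs are ≤ s, owner j₁
    -- has spoke colour s + 2 and all its ribs are ≥ s + 2, and the remaining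
    -- middle vertex has spoke colour s + 1.  So no rib has colour s + 1, and
    -- the shifted rib colours together with s + 4 are ten values in [s, s + 8].
    module _ (3+x₀≤s : 3 + x₀ ≤ s) (5+s≤x₁ : 5 + s ≤ x₁) where
      a b : Fin 3
      a = owner j₀
      b = owner j₁

      spoke-a : spokeColour a ≡ s
      spoke-a = ≤-antisym (≤-trans (spoke-below-rib (mid-degree≤ a) refl) 3+x₀≤s) (s-least a)

      spoke-b : spokeColour b ≡ 2 + s
      spoke-b = ≤-antisym (spokes-in-window b)
        (+-cancelˡ-≤ 3 _ _ (≤-trans 5+s≤x₁ (rib-below-spoke (mid-degree≤ b) refl)))

      ribs-of-a : ∀ j → owner j ≡ a → ribColour j ≤ s
      ribs-of-a j owns = ≤-trans (ribs-close (mid-degree≤ a) refl owns) 3+x₀≤s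

      ribs-of-b : ∀ j → owner j ≡ b → 2 + s ≤ ribColour j
      ribs-of-b j owns = +-cancelˡ-≤ 3 _ _ (≤-trans 5+s≤x₁ (ribs-close (mid-degree≤ b) owns refl))

      third-spoke : ∀ d → d ≢ a → d ≢ b → spokeColour d ≡ 1 + s
      third-spoke d d≢a d≢b = middle-value (s-least d) (spokes-in-window d)
        (λ eq → d≢a (spokeColour-injective (trans eq (sym spoke-a))))
        (λ eq → d≢b (spokeColour-injective (trans eq (sym spoke-b))))

      no-rib-coloured-1+s : ∀ j → ribColour j ≢ 1 + s
      no-rib-coloured-1+s j eq = by-owner (owner j Fin.≟ a) (owner j Fin.≟ b)
        where
        by-owner : Dec (owner j ≡ a) → Dec (owner j ≡ b) → ⊥
        by-owner (yes owns) _ = 1+n≰n (subst (_≤ s) eq (ribs-of-a j owns))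
        by-owner _ (yes owns) = 1+n≰n (subst (2 + s ≤_) eq (ribs-of-b j owns))
        by-owner (no ≢a) (no ≢b) =
          rib≢spoke {owner j} {j} refl (trans eq (sym (third-spoke (owner j) ≢a ≢b)))

      spread-case : ⊥
      spread-case = 1+n≰n (distinct-in-window extended s 8 extended-above extended-below
        (prepend-injective (4 + s) shifted (λ j eq → no-rib-coloured-1+s j (+-cancelˡ-≡ 3 _ _ eq))
          shifted-injective))
        where
        extended : Fin 10 → ℕ
        extended = prepend (4 + s) shifted

        extended-above : ∀ i → s ≤ extended i
        extended-above zero = m≤n+m s 4
        extended-above (suc j) = ribs-below j

        extended-below : ∀ i → extended i ≤ 8 + s
        extended-below zero = +-monoˡ-≤ s (m≤m+n 4 4)
        extended-below (suc j) = +-monoʳ-≤ 3 (ribs-above j)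

    no-colouring : ⊥
    no-colouring = by-extremes (s ≤? 2 + x₀) (x₁ ≤? 4 + s)
      where
      by-extremes : Dec (s ≤ 2 + x₀) → Dec (x₁ ≤ 4 + s) → ⊥
      by-extremes (yes s≤) _ = low-case s≤
      by-extremes _ (yes ≤s) = high-case ≤s
      by-extremes (no s≰) (no ≰s) = spread-case (≰⇒> s≰) (≰⇒> ≰s)

  counterexample : ∃[ G ] (Connected G × Bipartite G × MaxDegree G 9 × ¬ InN G)
  counterexample = graph , connected zero , bipartite , max-degree ,
                   λ (t , _ , col) → no-colouring col

-- Δ = 8 + p with p ≥ 2: middle vertices 0–3 own two ribs each (owner ⌊j/2⌋
-- on the first eight ribs), middle vertex four owns the remaining p ribs.
module LargeCounterexample (p : ℕ) where
  four : Fin 5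
  four = Fin.fromℕ 4

  owner : Fin (8 + p) → Fin 5
  owner j = [ (λ i → Fin.quotient {4} 2 i ↑ˡ 1) , (λ _ → four) ]′ (splitAt 8 j)

  open Fan 5 (8 + p) owner

  -- The degree of mid a is 1 + excess a.
  excess : Fin 5 → ℕ
  excess (suc (suc (suc (suc zero)))) = p
  excess _ = 2

  excess-other : ∀ a → a ≢ four → excess a ≡ 2
  excess-other zero _ = refl
  excess-other (suc zero) _ = refl
  excess-other (suc (suc zero)) _ = refl
  excess-other (suc (suc (suc zero))) _ = refl
  excess-other (suc (suc (suc (suc zero)))) ≢four = ⊥-elim (≢four refl)

  excess≤ : ∀ a → excess a ≤ 2 + p
  excess≤ a with a Fin.≟ four
  ... | yes refl = m≤n+m p 2
  ... | no ≢four = subst (_≤ 2 + p) (sym (excess-other a ≢four)) (m≤m+n 2 p)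

  excess-pair : 2 ≤ p → ∀ a b → a ≢ b → excess a + excess b ≤ 2 + p
  excess-pair 2≤p a b a≢b with a Fin.≟ four | b Fin.≟ four
  ... | yes refl | yes refl = ⊥-elim (a≢b refl)
  ... | yes refl | no ≢four rewrite excess-other b ≢four = ≤-reflexive (+-comm p 2)
  ... | no ≢four | yes refl rewrite excess-other a ≢four = ≤-refl
  ... | no ≢four₁ | no ≢four₂ rewrite excess-other a ≢four₁ | excess-other b ≢four₂ =
    +-monoʳ-≤ 2 2≤p

  -- The last p ribs all join mid four to top; every degree is a concrete
  -- count over the first thirteen edges plus a count over these.
  tail-ribs : List Edge
  tail-ribs = tabulate (λ i → rib (8 ↑ʳ i))

  tail-count : Vertex → ℕ
  tail-count v = length (filter (incident? graph v) tail-ribs)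

  tail-count-all : ∀ v → (∀ i → Incident graph (rib (8 ↑ʳ i)) v) → tail-count v ≡ p
  tail-count-all v at-v = trans (cong length (filter-all (incident? graph v) (tabulate⁺ at-v)))
                                (length-tabulate (λ i → rib (8 ↑ʳ i)))

  tail-count-none : ∀ v → v ≢ mid four → v ≢ top → tail-count v ≡ 0
  tail-count-none v ≢four ≢top = cong length (filter-none (incident? graph v) (tabulate⁺ avoids))
    where
    avoids : ∀ i → ¬ Incident graph (rib (8 ↑ʳ i)) v
    avoids i (inj₁ eq) = ≢four (sym eq)
    avoids i (inj₂ eq) = ≢top (sym eq)

  hub-degree : degree graph hub ≡ 5
  hub-degree = cong (5 +_) (tail-count-none hub (λ ()) (λ ()))

  top-degree : degree graph top ≡ 8 + p
  top-degree = cong (8 +_) (tail-count-all top (λ i → rib-at-top (8 ↑ʳ i)))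

  mid-degree : ∀ a → degree graph (mid a) ≡ suc (excess a)
  mid-degree a@zero = cong (3 +_) (tail-count-none (mid a) (λ ()) (λ ()))
  mid-degree a@(suc zero) = cong (3 +_) (tail-count-none (mid a) (λ ()) (λ ()))
  mid-degree a@(suc (suc zero)) = cong (3 +_) (tail-count-none (mid a) (λ ()) (λ ()))
  mid-degree a@(suc (suc (suc zero))) = cong (3 +_) (tail-count-none (mid a) (λ ()) (λ ()))
  mid-degree (suc (suc (suc (suc zero)))) = cong (1 +_) (tail-count-all (mid four) (λ i → rib-at-mid {8 ↑ʳ i} refl))

  max-degree : MaxDegree graph (8 + p)
  max-degree = bound , top , top-degree
    where
    bound : ∀ v → degree graph v ≤ 8 + p
    bound zero = subst (_≤ 8 + p) (sym hub-degree) (m≤m+n 5 (3 + p))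
    bound (suc zero) = ≤-reflexive top-degree
    bound (suc (suc a)) = subst (_≤ 8 + p) (sym (mid-degree a))
      (≤-trans (s≤s (excess≤ a)) (m≤n+m (3 + p) 5))

  -- Every rib colour is within 6 + p of the least rib colour x₀, either
  -- through a shared middle vertex or through two middle vertices and the
  -- hub; so the 8 + p distinct rib colours lie in a window of 7 + p values.
  module _ (2≤p : 2 ≤ p) {t : ℕ} (col : IntervalColoring graph t) where
    open Coloured col

    mid-degree≤ : ∀ a → degree graph (mid a) ≤ suc (excess a)
    mid-degree≤ a = ≤-reflexive (mid-degree a)

    module _ (j₀ : Fin (8 + p)) (j₀-least : ∀ j → ribColour j₀ ≤ ribColour j) where
      x₀ : ℕ
      x₀ = ribColour j₀

      via-hub : ∀ j → owner j ≢ owner j₀ → ribColour j ≤ (6 + p) + x₀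
      via-hub j a≢b = begin
        ribColour j                        ≤⟨ rib-below-spoke (mid-degree≤ a) refl ⟩
        excess a + spokeColour a           ≤⟨ +-monoʳ-≤ (excess a) (spokes-close (≤-reflexive hub-degree) b a) ⟩
        excess a + (4 + spokeColour b)     ≤⟨ +-monoʳ-≤ (excess a) (+-monoʳ-≤ 4 (spoke-below-rib (mid-degree≤ b) refl)) ⟩
        excess a + (4 + (excess b + x₀))   ≡⟨ regroup (excess a) (excess b) ⟩
        (4 + (excess a + excess b)) + x₀   ≤⟨ +-monoˡ-≤ x₀ (+-monoʳ-≤ 4 (excess-pair 2≤p a b a≢b)) ⟩
        (6 + p) + x₀                       ∎
        where
        open ≤-Reasoning
        a b : Fin 5
        a = owner j
        b = owner j₀
        regroup : ∀ m n → m + (4 + (n + x₀)) ≡ (4 + (m + n)) + x₀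
        regroup m n = begin-equality
          m + (4 + (n + x₀))   ≡⟨ +-assoc m 4 (n + x₀) ⟨
          (m + 4) + (n + x₀)   ≡⟨ cong (_+ (n + x₀)) (+-comm m 4) ⟩
          (4 + m) + (n + x₀)   ≡⟨ +-assoc (4 + m) n x₀ ⟨
          (4 + m + n) + x₀     ≡⟨ cong (_+ x₀) (+-assoc 4 m n) ⟩
          (4 + (m + n)) + x₀   ∎

      via-mid : ∀ j → owner j ≡ owner j₀ → ribColour j ≤ (6 + p) + x₀
      via-mid j same = ≤-trans (ribs-close (mid-degree≤ (owner j₀)) refl same)
        (+-monoˡ-≤ x₀ (≤-trans (excess≤ (owner j₀)) (m≤n+m (2 + p) 4)))

      too-many-ribs : ⊥
      too-many-ribs = 1+n≰n (distinct-in-window ribColour x₀ (6 + p) j₀-least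
        (λ j → by-owner j (owner j Fin.≟ owner j₀)) ribColour-injective)
        where
        by-owner : ∀ j → Dec (owner j ≡ owner j₀) → ribColour j ≤ (6 + p) + x₀
        by-owner j (yes same) = via-mid j same
        by-owner j (no a≢b) = via-hub j a≢b

    no-colouring : ⊥
    no-colouring = too-many-ribs (proj₁ (minimiser ribColour)) (proj₂ (minimiser ribColour))

  counterexample : 2 ≤ p → ∃[ G ] (Connected G × Bipartite G × MaxDegree G (8 + p) × ¬ InN G)
  counterexample 2≤p = graph , connected zero , bipartite , max-degree ,
                       λ (t , _ , col) → no-colouring 2≤p col

Counterexample : ℕ → Set
Counterexample Δ = ∃[ G ] (Connected G × Bipartite G × MaxDegree G Δ × ¬ InN G)

-- Δ = 9 is the nine-rib fan; Δ ≥ 10 is the large fan with p = Δ - 8 ≥ 2.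
corollary5 : ∀ (Δ : ℕ) → 9 ≤ Δ →
    ∃[ G ] (Connected G × Bipartite G × MaxDegree G Δ × ¬ InN G)
corollary5 Δ 9≤Δ with m≤n⇒m<n∨m≡n 9≤Δ
... | inj₂ refl = NineCounterexample.counterexample
... | inj₁ 10≤Δ = subst Counterexample (m+[n∸m]≡n 8≤Δ)
                    (LargeCounterexample.counterexample (Δ ∸ 8) (∸-monoˡ-≤ 8 10≤Δ))
  where
  8≤Δ : 8 ≤ Δ
  8≤Δ = ≤-trans (n≤1+n 8) 9≤Δ
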